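{- For all $r,n\ge0$ there is a bijection $w\mapsto(w_0,v_1,\dots,v_k)$ from $W_n(r)=\{0,\dots,r\}^n$ onto the set of sequences $(w_0,v_1,\dots,v_k)$ ($k\ge0$), where $w_0$ is a nondecreasing word over $\{0,\dots,r\}$, each $v_j$ is a $V$-word with letters at most $r$, and the total length is $n$, such that $w_0v_1v_2\cdots v_k$ is a rearrangement of $w$ and $\mathrm{dec}\,w=\mathrm{dec}\,v_1+\mathrm{dec}\,v_2+\cdots+\mathrm{dec}\,v_k$. (In words: to each word $w$ of nonnegative integers there corresponds a unique such sequence.)
   Context: A $V$-word is a word $x_1\cdots x_n$ of nonnegative integers, $n\ge2$, such that for some $1\le i\le n-1$: $x_1\ge\cdots\ge x_i>x_{i+1}$ and $x_{i+1}\le\cdots\le x_n<x_i$. For $w=x_1\cdots x_n$, $i\in\{1,\dots,n-1\}$ is a decrease if $x_i\ge x_{i+1}\ge\cdots\ge x_j>x_{j+1}$ for some $i\le j\le n-1$; $\mathrm{dec}\,w$ is the number of decreases. -}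

module Defs where

open import Data.Nat using (ℕ; zero; suc; _+_; _≤_; _<_; _≥_; _<ᵇ_; _≡ᵇ_)
open import Data.Bool using (Bool; true; false; if_then_else_; _∧_; _∨_)
open import Data.List using (List; []; _∷_; _++_; [_]; length; map)
open import Data.Nat.ListAction using (sum)
open import Data.List.Relation.Unary.All using (All)
open import Data.List.Relation.Unary.Linked using (Linked)
open import Data.Product using (Σ; ∃; _×_; _,_)
open import Relation.Binary.PropositionalEquality using (_≡_)

Letters≤ : ℕ → List ℕ → Set
Letters≤ r w = All (_≤ r) w

W : ℕ → ℕ → Set
W r n = Σ (List ℕ) λ w → length w ≡ n × Letters≤ r w

Nondecreasing : List ℕ → Set
Nondecreasing = Linked _≤_

Nonincreasing : List ℕ → Set
Nonincreasing = Linked _≥_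

lastOf : ℕ → List ℕ → ℕ
lastOf x []       = x
lastOf x (y ∷ ys) = lastOf y ys

-- V-word: x₁⋯xₙ = (u ++ [a]) ++ (b ∷ s) with x_i = a, x_{i+1} = b,
-- x₁ ≥ ⋯ ≥ x_i > x_{i+1}, x_{i+1} ≤ ⋯ ≤ xₙ < x_i   (so n ≥ 2 automatically)
IsVWord : List ℕ → Set
IsVWord v = Σ (List ℕ) λ u → Σ ℕ λ a → Σ ℕ λ b → Σ (List ℕ) λ s →
  (v ≡ u ++ a ∷ b ∷ s) × Nonincreasing (u ++ [ a ]) × a > b ×
  Nondecreasing (b ∷ s) × lastOf b s < a
  where
  _>_ : ℕ → ℕ → Set
  m > n = n < m

-- isDecStart (x_i ∷ x_{i+1} ∷ ⋯) = true iff i is a decrease, i.e.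
-- x_i ≥ x_{i+1} ≥ ⋯ ≥ x_j > x_{j+1} for some j ≥ i:
-- either x_i > x_{i+1}, or x_i = x_{i+1} and i+1 is a decrease.
isDecStart : List ℕ → Bool
isDecStart []           = false
isDecStart (x ∷ [])     = false
isDecStart (x ∷ y ∷ ys) = (y <ᵇ x) ∨ ((y ≡ᵇ x) ∧ isDecStart (y ∷ ys))

dec : List ℕ → ℕ
dec []       = 0
dec (x ∷ xs) = (if isDecStart (x ∷ xs) then 1 else 0) + dec xs

Seqs : ℕ → ℕ → Set
Seqs r n = Σ (List ℕ × List (List ℕ)) λ where
  (w₀ , vs) → Nondecreasing w₀ × Letters≤ r w₀ ×
              All (λ v → IsVWord v × Letters≤ r v) vs ×
              length w₀ + sum (map length vs) ≡ n

module Submission where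

-- Induction on the largest letter.  With m = r + 1, a word over {0,…,m} factors uniquely as
-- u₀ m^(1+k₁) u₁ ⋯ m^(1+kⱼ) uⱼ m^t with all uᵢ words over {0,…,r} and u₁,…,uⱼ nonempty.
-- Decompose u₀ recursively into (a, vs) and keep (a m^t, vs).  Decompose each uᵢ recursively as
-- well; its lead x (the nondecreasing word if nonempty, otherwise the first V-word) turns
-- m^(1+kᵢ) x into a V-word, followed by the remaining V-words of uᵢ.  The new V-words are exactly
-- those beginning with m, so the construction can be undone; and since a plateau m^(1+k) before
-- smaller letters makes 1+k decreases while an ascent into m makes none, dec is additive.

open import Defs
open import Data.Nat using (ℕ; zero; suc; _+_; _≤_; _<_; _<ᵇ_; _≡ᵇ_; _≟_; _<?_; _≤?_; z≤n; s≤s)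
open import Data.Nat.Properties
open import Data.Bool using (true; false; if_then_else_; _∧_; _∨_)
open import Data.Bool.Properties using (∧-zeroʳ)
open import Data.Maybe.Relation.Unary.All as Maybe using (just; nothing)
open import Data.List using (List; []; _∷_; _++_; [_]; head; length; replicate; concat; map)
open import Data.Nat.ListAction using (sum)
open import Data.List.Properties
  using (++-assoc; ++-identityʳ; concat-++; map-++; length-++; ∷-injectiveʳ; ∷-injectiveˡ)
open import Data.Nat.ListAction.Properties using (sum-++)
open import Data.List.Relation.Unary.All as All using (All; []; _∷_)
open import Data.List.Relation.Unary.All.Properties using (++⁺; ++⁻ˡ; ++⁻ʳ; replicate⁺; concat⁺)
open import Data.List.Relation.Unary.Linked as Linked using ([]; [-]; _∷_)
open import Data.List.Relation.Unary.Linked.Properties using (Linked⇒All)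
open import Data.Product using (Σ; _×_; _,_; proj₁; proj₂; map₁; map₂)
open import Data.Empty using (⊥-elim)
open import Data.List.Relation.Binary.Permutation.Propositional
  using (_↭_; ↭-refl; ↭-reflexive; ↭-trans; ↭-sym; module PermutationReasoning)
open import Data.List.Relation.Binary.Permutation.Propositional.Properties using (++⁺ˡ; ++-comm; ↭-length; All-resp-↭)
  renaming (++⁺ to ↭-++⁺)
open import Function using (flip; _∘_)
open import Function.Bundles using (_⤖_; Bijection; mk↔ₛ′)
open import Function.Properties.Inverse using (↔⇒⤖)
open import Relation.Nullary using (¬_)
open import Relation.Nullary.Decidable using (Dec; yes; no; dec-true; dec-false; dec-no; dec-yes-irr)
open import Relation.Binary.PropositionalEquality hiding ([_])

<ᵇ-false : ∀ {m n} → m ≤ n → (n <ᵇ m) ≡ false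
<ᵇ-false m≤n = dec-false (_ <? _) (≤⇒≯ m≤n)

<ᵇ-true : ∀ {m n} → m < n → (m <ᵇ n) ≡ true
<ᵇ-true = dec-true (_ <? _)

≡ᵇ-refl : ∀ m → (m ≡ᵇ m) ≡ true
≡ᵇ-refl m = dec-true (m ≟ m) refl

≡ᵇ-false : ∀ {m n} → m ≢ n → (m ≡ᵇ n) ≡ false
≡ᵇ-false m≢n = dec-false (_ ≟ _) m≢n

isDecStart-nondecreasing : ∀ {x xs} → Nondecreasing (x ∷ xs) → isDecStart (x ∷ xs) ≡ false
isDecStart-nondecreasing [-] = refl
isDecStart-nondecreasing {x} {y ∷ _} (x≤y ∷ ys↗)
  rewrite <ᵇ-false x≤y | isDecStart-nondecreasing ys↗ = ∧-zeroʳ (y ≡ᵇ x)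

dec-nondecreasing : ∀ {w} → Nondecreasing w → dec w ≡ 0
dec-nondecreasing [] = refl
dec-nondecreasing [-] = refl
dec-nondecreasing w↗@(_ ∷ ys↗) rewrite isDecStart-nondecreasing w↗ = dec-nondecreasing ys↗

BelowHead : List ℕ → List ℕ → Set
BelowHead p q = Maybe.All (λ h → All (_< h) p) (head q)

isDecStart-++ : ∀ x p q → BelowHead (x ∷ p) q → isDecStart ((x ∷ p) ++ q) ≡ isDecStart (x ∷ p)
isDecStart-++ x [] [] _ = refl
isDecStart-++ x [] (h ∷ q) (just (x<h ∷ []))
  rewrite <ᵇ-false (<⇒≤ x<h) | ≡ᵇ-false (>⇒≢ x<h) = refl
isDecStart-++ x (y ∷ p) q below rewrite isDecStart-++ y p q (Maybe.map All.tail below) = refl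

dec-++ : ∀ p q → BelowHead p q → dec (p ++ q) ≡ dec p + dec q
dec-++ [] q _ = refl
dec-++ (x ∷ p) q below
  rewrite isDecStart-++ x p q below | dec-++ p q (Maybe.map All.tail below) =
  sym (+-assoc (if isDecStart (x ∷ p) then 1 else 0) (dec p) (dec q))

isDecStart-plateau : ∀ k {m h q} → h < m → isDecStart (m ∷ replicate k m ++ h ∷ q) ≡ true
isDecStart-plateau zero h<m rewrite <ᵇ-true h<m = refl
isDecStart-plateau (suc k) {m} h<m =
  cong₂ _∨_ (<ᵇ-false (≤-refl {m})) (cong₂ _∧_ (≡ᵇ-refl m) (isDecStart-plateau k h<m))

dec-plateau : ∀ k {m h q} → h < m → dec (replicate k m ++ h ∷ q) ≡ k + dec (h ∷ q)
dec-plateau zero h<m = refl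
dec-plateau (suc k) h<m =
  cong₂ (λ b n → (if b then 1 else 0) + n) (isDecStart-plateau k h<m) (dec-plateau k h<m)

≤∧≢⇒≤pred : ∀ {x r} → x ≤ suc r → x ≢ suc r → x ≤ r
≤∧≢⇒≤pred x≤1+r x≢1+r = m<1+n⇒m≤n (≤∧≢⇒< x≤1+r x≢1+r)

letters≤-suc : ∀ {r w} → Letters≤ r w → Letters≤ (suc r) w
letters≤-suc = All.map m≤n⇒m≤1+n

replicate-suc-++ : ∀ k (m : ℕ) xs → replicate (suc k) m ++ xs ≡ replicate k m ++ m ∷ xs
replicate-suc-++ zero m xs = refl
replicate-suc-++ (suc k) m xs = cong (m ∷_) (replicate-suc-++ k m xs)

nonincreasing-replicate-++ : ∀ k {m l} → Nonincreasing l → Letters≤ m l → Nonincreasing (replicate k m ++ l)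
nonincreasing-replicate-++ zero l↘ _ = l↘
nonincreasing-replicate-++ (suc zero) [] _ = [-]
nonincreasing-replicate-++ (suc zero) {l = _ ∷ _} l↘ (y≤m ∷ _) = y≤m ∷ l↘
nonincreasing-replicate-++ (suc (suc k)) l↘ l≤m = ≤-refl ∷ nonincreasing-replicate-++ (suc k) l↘ l≤m

nonincreasing⇒All≤head : ∀ {x l} → Nonincreasing (x ∷ l) → Letters≤ x (x ∷ l)
nonincreasing⇒All≤head = Linked⇒All (flip ≤-trans) ≤-refl

All-lastOf : ∀ {P : ℕ → Set} {b} s → All P (b ∷ s) → P (lastOf b s)
All-lastOf [] (pb ∷ _) = pb
All-lastOf (c ∷ s) (_ ∷ ps) = All-lastOf s ps

nondecreasing⇒All< : ∀ {a b s} → Nondecreasing (b ∷ s) → lastOf b s < a → All (_< a) (b ∷ s)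
nondecreasing⇒All< [-] last<a = last<a ∷ []
nondecreasing⇒All< (b≤c ∷ c∷s↗) last<a with nondecreasing⇒All< c∷s↗ last<a
... | c<a ∷ s<a = ≤-<-trans b≤c c<a ∷ c<a ∷ s<a

nondecreasing⇒¬descent : ∀ p {a b s} → Nondecreasing (p ++ a ∷ b ∷ s) → ¬ b < a
nondecreasing⇒¬descent [] (a≤b ∷ _) = ≤⇒≯ a≤b
nondecreasing⇒¬descent (_ ∷ p) p↗ = nondecreasing⇒¬descent p (Linked.tail p↗)

data NonEmpty : List ℕ → Set where
  nonEmpty : ∀ {x xs} → NonEmpty (x ∷ xs)

NotHead : ℕ → List ℕ → Set
NotHead m v = Maybe.All (_≢ m) (head v)

VWord≤ : ℕ → List ℕ → Set
VWord≤ r v = IsVWord v × Letters≤ r v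

VWord-nonEmpty : ∀ {v} → IsVWord v → NonEmpty v
VWord-nonEmpty ([] , _ , _ , _ , refl , _) = nonEmpty
VWord-nonEmpty (_ ∷ _ , _ , _ , _ , refl , _) = nonEmpty

VWord-¬nondecreasing : ∀ {v} → IsVWord v → ¬ Nondecreasing v
VWord-¬nondecreasing (u , _ , _ , _ , refl , _ , b<a , _) v↗ = nondecreasing⇒¬descent u v↗ b<a

VWord-valley : ∀ {m b s} → Nondecreasing (b ∷ s) → All (_< m) (b ∷ s) → IsVWord (m ∷ b ∷ s)
VWord-valley {s = s} b∷s↗ b∷s<m@(b<m ∷ _) = [] , _ , _ , s , refl , [-] , b<m , b∷s↗ , All-lastOf s b∷s<m

VWord-raise : ∀ k {m v} → IsVWord v → Letters≤ m v → IsVWord (replicate k m ++ v)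
VWord-raise k {m} (u , a , b , s , refl , u↘ , b<a , b∷s↗ , last<a) v≤m =
  replicate k m ++ u , a , b , s , sym (++-assoc (replicate k m) u (a ∷ b ∷ s)) ,
  subst Nonincreasing (sym (++-assoc (replicate k m) u [ a ]))
    (nonincreasing-replicate-++ k u↘ (++⁺ (++⁻ˡ u v≤m) (All.head (++⁻ʳ u v≤m) ∷ []))) ,
  b<a , b∷s↗ , last<a

VWord-≤-head : ∀ {h v} → IsVWord (h ∷ v) → Letters≤ h (h ∷ v)
VWord-≤-head ([] , a , b , s , refl , _ , _ , b∷s↗ , last<a) =
  ≤-refl ∷ All.map <⇒≤ (nondecreasing⇒All< b∷s↗ last<a)
VWord-≤-head {h} (_ ∷ u , a , b , s , refl , h∷u↘ , _ , b∷s↗ , last<a) =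
  subst (Letters≤ h) (++-assoc (h ∷ u) [ a ] (b ∷ s))
    (++⁺ prefix≤h (All.map (λ c<a → <⇒≤ (<-≤-trans c<a a≤h)) (nondecreasing⇒All< b∷s↗ last<a)))
  where
  prefix≤h = nonincreasing⇒All≤head h∷u↘
  a≤h = All.head (++⁻ʳ (h ∷ u) prefix≤h)

VWord-lower : ∀ {r v} → IsVWord v → Letters≤ (suc r) v → NotHead (suc r) v → Letters≤ r v
VWord-lower v-V [] _ with () ← VWord-nonEmpty v-V
VWord-lower v-V (h≤1+r ∷ _) (just h≢1+r) =
  All.map (λ c≤h → ≤-trans c≤h (≤∧≢⇒≤pred h≤1+r h≢1+r)) (VWord-≤-head v-V)

data VTail (r : ℕ) : List ℕ → Set where
  rise   : ∀ {b s} → Nondecreasing (b ∷ s) → Letters≤ r (b ∷ s) → VTail r (b ∷ s)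
  valley : ∀ {v} → VWord≤ r v → VTail r v

VTail-letters : ∀ {r x} → VTail r x → Letters≤ r x
VTail-letters (rise _ x≤r) = x≤r
VTail-letters (valley (_ , x≤r)) = x≤r

VTail-plateau : ∀ k {r x} → VTail r x → IsVWord (replicate (suc k) (suc r) ++ x)
VTail-plateau k {r} (rise {b} {s} b∷s↗ b∷s≤r) =
  subst IsVWord (sym (replicate-suc-++ k (suc r) (b ∷ s)))
    (VWord-raise k (VWord-valley b∷s↗ (All.map s≤s b∷s≤r)) (≤-refl ∷ letters≤-suc b∷s≤r))
VTail-plateau k (valley (x-V , x≤r)) = VWord-raise (suc k) x-V (letters≤-suc x≤r)

plateau-VTail : ∀ k {r x} → IsVWord (replicate (suc k) (suc r) ++ x) →
                NotHead (suc r) x → Letters≤ (suc r) x → VTail r x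
plateau-VTail zero ([] , _ , _ , _ , refl , _ , _ , b∷s↗ , last<m) _ _ =
  rise b∷s↗ (All.map m<1+n⇒m≤n (nondecreasing⇒All< b∷s↗ last<m))
plateau-VTail (suc k) ([] , _ , _ , _ , refl , _ , m<m , _) _ _ = ⊥-elim (<-irrefl refl m<m)
plateau-VTail zero (_ ∷ u , a , b , s , refl , u↘ , b<a , b∷s↗ , last<a) x≢m x≤m =
  valley (x-V , VWord-lower x-V x≤m x≢m)
  where
  x-V : IsVWord (u ++ a ∷ b ∷ s)
  x-V = u , a , b , s , refl , Linked.tail u↘ , b<a , b∷s↗ , last<a
plateau-VTail (suc k) (_ ∷ u , a , b , s , eq , u↘ , b<a , b∷s↗ , last<a) =
  plateau-VTail k (u , a , b , s , ∷-injectiveʳ eq , Linked.tail u↘ , b<a , b∷s↗ , last<a)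

descent-unique : ∀ u {a b s} u′ {a′ b′ s′} → u ++ a ∷ b ∷ s ≡ u′ ++ a′ ∷ b′ ∷ s′ →
                 b < a → b′ < a′ → Nondecreasing (b ∷ s) → Nondecreasing (b′ ∷ s′) →
                 u ≡ u′ × a ≡ a′ × b ≡ b′ × s ≡ s′
descent-unique [] [] refl _ _ _ _ = refl , refl , refl , refl
descent-unique [] (_ ∷ u′) eq _ b′<a′ b∷s↗ _ =
  ⊥-elim (nondecreasing⇒¬descent u′ (subst Nondecreasing (∷-injectiveʳ eq) b∷s↗) b′<a′)
descent-unique (_ ∷ u) [] eq b<a _ _ b′∷s′↗ =
  ⊥-elim (nondecreasing⇒¬descent u (subst Nondecreasing (sym (∷-injectiveʳ eq)) b′∷s′↗) b<a)
descent-unique (x ∷ u) (x′ ∷ u′) eq b<a b′<a′ b∷s↗ b′∷s′↗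
  with refl ← ∷-injectiveˡ eq
     | refl , refl , refl , refl ← descent-unique u u′ (∷-injectiveʳ eq) b<a b′<a′ b∷s↗ b′∷s′↗ =
  refl , refl , refl , refl

IsVWord-irrelevant : ∀ {v} (p q : IsVWord v) → p ≡ q
IsVWord-irrelevant (u , a , b , s , refl , u↘ , b<a , b∷s↗ , last<a)
                   (u′ , a′ , b′ , s′ , eq , u′↘ , b′<a′ , b′∷s′↗ , last′<a′)
  with refl , refl , refl , refl ← descent-unique u u′ eq b<a b′<a′ b∷s↗ b′∷s′↗
  with refl ← eq
  rewrite Linked.irrelevant ≤-irrelevant u↘ u′↘ | ≤-irrelevant b<a b′<a′
        | Linked.irrelevant ≤-irrelevant b∷s↗ b′∷s′↗ | ≤-irrelevant last<a last′<a′ = refl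

Block : Set
Block = ℕ × List ℕ

blocksWord : ℕ → List Block → ℕ → List ℕ
blocksWord m [] t = replicate t m
blocksWord m ((k , u) ∷ bs) t = replicate (suc k) m ++ u ++ blocksWord m bs t

data Factorisation : Set where
  factors : List ℕ → List Block → ℕ → Factorisation

unfactorise : ℕ → Factorisation → List ℕ
unfactorise m (factors u₀ bs t) = u₀ ++ blocksWord m bs t

consMax : Factorisation → Factorisation
consMax (factors [] [] t) = factors [] [] (suc t)
consMax (factors [] ((k , u) ∷ bs) t) = factors [] ((suc k , u) ∷ bs) t
consMax (factors u₀@(_ ∷ _) bs t) = factors [] ((0 , u₀) ∷ bs) t

consOther : ℕ → Factorisation → Factorisation
consOther x (factors u₀ bs t) = factors (x ∷ u₀) bs t

factorise : ℕ → List ℕ → Factorisation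
factorise m [] = factors [] [] 0
factorise m (x ∷ xs) with x ≟ m
... | yes _ = consMax (factorise m xs)
... | no _ = consOther x (factorise m xs)

factorise-max : ∀ m xs → factorise m (m ∷ xs) ≡ consMax (factorise m xs)
factorise-max m xs rewrite ≟-diag {m} refl = refl

factorise-other : ∀ {m x} xs → x ≢ m → factorise m (x ∷ xs) ≡ consOther x (factorise m xs)
factorise-other {m} {x} xs x≢m rewrite dec-no (x ≟ m) x≢m = refl

unfactorise-consMax : ∀ m F → unfactorise m (consMax F) ≡ m ∷ unfactorise m F
unfactorise-consMax m (factors [] [] t) = refl
unfactorise-consMax m (factors [] ((k , u) ∷ bs) t) = refl
unfactorise-consMax m (factors (_ ∷ _) bs t) = refl

unfactorise-consOther : ∀ m x F → unfactorise m (consOther x F) ≡ x ∷ unfactorise m F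
unfactorise-consOther m x (factors _ _ _) = refl

unfactorise-factorise : ∀ m w → unfactorise m (factorise m w) ≡ w
unfactorise-factorise m [] = refl
unfactorise-factorise m (x ∷ xs) with x ≟ m
... | yes refl = trans (unfactorise-consMax m (factorise m xs)) (cong (m ∷_) (unfactorise-factorise m xs))
... | no _ = trans (unfactorise-consOther m x (factorise m xs)) (cong (x ∷_) (unfactorise-factorise m xs))

BlockBelow : ℕ → Block → Set
BlockBelow r (_ , u) = NonEmpty u × Letters≤ r u

FactorsBelow : ℕ → Factorisation → Set
FactorsBelow r (factors u₀ bs _) = Letters≤ r u₀ × All (BlockBelow r) bs

consMax-below : ∀ {r} F → FactorsBelow r F → FactorsBelow r (consMax F)
consMax-below (factors [] [] t) below = below
consMax-below (factors [] ((k , u) ∷ bs) t) ([] , u-below ∷ bs-below) = [] , u-below ∷ bs-below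
consMax-below (factors (_ ∷ _) bs t) (u₀≤r , bs-below) = [] , (nonEmpty , u₀≤r) ∷ bs-below

factorise-below : ∀ {r} w → Letters≤ (suc r) w → FactorsBelow r (factorise (suc r) w)
factorise-below [] _ = [] , []
factorise-below {r} (x ∷ xs) (x≤1+r ∷ xs≤1+r) with x ≟ suc r
... | yes _ = consMax-below (factorise (suc r) xs) (factorise-below xs xs≤1+r)
... | no x≢1+r with factorise (suc r) xs | factorise-below xs xs≤1+r
...   | factors _ _ _ | u₀≤r , bs-below = ≤∧≢⇒≤pred x≤1+r x≢1+r ∷ u₀≤r , bs-below

factorise-replicate : ∀ m t → factorise m (replicate t m) ≡ factors [] [] t
factorise-replicate m zero = refl
factorise-replicate m (suc t) = trans (factorise-max m _) (cong consMax (factorise-replicate m t))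

factorise-plateau : ∀ k {m R y u bs t} → factorise m R ≡ factors (y ∷ u) bs t →
                    factorise m (replicate (suc k) m ++ R) ≡ factors [] ((k , y ∷ u) ∷ bs) t
factorise-plateau zero {m} {R} eq = trans (factorise-max m R) (cong consMax eq)
factorise-plateau (suc k) {m} {R} eq =
  trans (factorise-max m (replicate (suc k) m ++ R)) (cong consMax (factorise-plateau k {m} eq))

factorise-lower-++ : ∀ {r} u {R bs t} → Letters≤ r u → factorise (suc r) R ≡ factors [] bs t →
                     factorise (suc r) (u ++ R) ≡ factors u bs t
factorise-lower-++ [] _ eq = eq
factorise-lower-++ (x ∷ u) (x≤r ∷ u≤r) eq =
  trans (factorise-other (u ++ _) (<⇒≢ (s≤s x≤r))) (cong (consOther x) (factorise-lower-++ u u≤r eq))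

factorise-blocksWord : ∀ {r} bs t → All (BlockBelow r) bs →
                       factorise (suc r) (blocksWord (suc r) bs t) ≡ factors [] bs t
factorise-blocksWord {r} [] t _ = factorise-replicate (suc r) t
factorise-blocksWord {r} ((k , y ∷ u) ∷ bs) t ((nonEmpty , u≤r) ∷ bs-below) =
  factorise-plateau k {suc r} (factorise-lower-++ (y ∷ u) u≤r (factorise-blocksWord bs t bs-below))

factorise-unfactorise : ∀ {r} F → FactorsBelow r F → factorise (suc r) (unfactorise (suc r) F) ≡ F
factorise-unfactorise (factors u₀ bs t) (u₀≤r , bs-below) =
  factorise-lower-++ u₀ u₀≤r (factorise-blocksWord bs t bs-below)

nondecreasing-factors : ∀ {r w} → Nondecreasing w → Letters≤ (suc r) w →
                        Σ (List ℕ) λ a → Σ ℕ λ t →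
                          w ≡ a ++ replicate t (suc r) × Nondecreasing a × Letters≤ r a
nondecreasing-factors {w = []} _ _ = [] , 0 , refl , [] , []
nondecreasing-factors {r} {x ∷ xs} w↗ (x≤1+r ∷ xs≤1+r) with nondecreasing-factors (Linked.tail w↗) xs≤1+r
... | [] , t , refl , _ , _ with x ≟ suc r
...   | yes refl = [] , suc t , refl , [] , []
...   | no x≢1+r = [ x ] , t , refl , [-] , ≤∧≢⇒≤pred x≤1+r x≢1+r ∷ []
nondecreasing-factors {r} {x ∷ xs} w↗ _ | y ∷ a , t , refl , a↗ , a≤r@(y≤r ∷ _) =
  x ∷ y ∷ a , t , refl , Linked.head w↗ ∷ a↗ , ≤-trans (Linked.head w↗) y≤r ∷ a≤r

VSeq : Set
VSeq = List ℕ × List (List ℕ)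

flatten : VSeq → List ℕ
flatten (w₀ , vs) = w₀ ++ concat vs

decSum : VSeq → ℕ
decSum (w₀ , vs) = dec w₀ + sum (map dec vs)

ValidVSeq : ℕ → VSeq → Set
ValidVSeq r (w₀ , vs) = Nondecreasing w₀ × Letters≤ r w₀ × All (VWord≤ r) vs

ValidLead : ℕ → VSeq → Set
ValidLead r (x , ws) = VTail r x × All (VWord≤ r) ws

lead : VSeq → VSeq
lead ([] , v ∷ vs) = v , vs
lead s = s

nondecreasing? : ∀ w → Dec (Nondecreasing w)
nondecreasing? = Linked.linked? _≤?_

unlead : VSeq → VSeq
unlead (x , ws) with nondecreasing? x
... | yes _ = x , ws
... | no _ = [] , x ∷ ws

flatten-lead : ∀ s → flatten (lead s) ≡ flatten s
flatten-lead ([] , []) = refl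
flatten-lead ([] , v ∷ vs) = refl
flatten-lead (_ ∷ _ , vs) = refl

flatten-unlead : ∀ l → flatten (unlead l) ≡ flatten l
flatten-unlead (x , ws) with nondecreasing? x
... | yes _ = refl
... | no _ = refl

decSum-lead : ∀ s → decSum (lead s) ≡ decSum s
decSum-lead ([] , []) = refl
decSum-lead ([] , v ∷ vs) = refl
decSum-lead (_ ∷ _ , vs) = refl

lead-valid : ∀ {r} s → ValidVSeq r s → NonEmpty (flatten s) → ValidLead r (lead s)
lead-valid ([] , v ∷ vs) (_ , _ , v-ok ∷ vs-ok) _ = valley v-ok , vs-ok
lead-valid (_ ∷ _ , vs) (w₀↗ , w₀≤r , vs-ok) _ = rise w₀↗ w₀≤r , vs-ok

unlead-lead : ∀ {r} s → ValidVSeq r s → NonEmpty (flatten s) → unlead (lead s) ≡ s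
unlead-lead ([] , v ∷ vs) (_ , _ , (v-V , _) ∷ _) _
  rewrite dec-no (nondecreasing? v) (VWord-¬nondecreasing v-V) = refl
unlead-lead (w₀@(_ ∷ _) , vs) (w₀↗ , _) _
  rewrite dec-yes-irr (nondecreasing? w₀) (Linked.irrelevant ≤-irrelevant) w₀↗ = refl

unlead-valid : ∀ {r} l → ValidLead r l → ValidVSeq r (unlead l) × lead (unlead l) ≡ l
unlead-valid (x , ws) (rise x↗ x≤r , ws-ok)
  rewrite dec-yes-irr (nondecreasing? x) (Linked.irrelevant ≤-irrelevant) x↗ = (x↗ , x≤r , ws-ok) , refl
unlead-valid (x , ws) (valley x-ok@(x-V , _) , ws-ok)
  rewrite dec-no (nondecreasing? x) (VWord-¬nondecreasing x-V) = ([] , [] , x-ok ∷ ws-ok) , refl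

VTail-nonEmpty : ∀ {r x} → VTail r x → NonEmpty x
VTail-nonEmpty (rise _ _) = nonEmpty
VTail-nonEmpty (valley (x-V , _)) = VWord-nonEmpty x-V

Group : Set
Group = ℕ × VSeq

groupsWords : ℕ → List Group → List (List ℕ)
groupsWords m [] = []
groupsWords m ((k , x , ws) ∷ gs) = (replicate (suc k) m ++ x) ∷ ws ++ groupsWords m gs

peel : ℕ → List ℕ → ℕ × List ℕ
peel m [] = 0 , []
peel m (x ∷ xs) with x ≟ m
... | yes _ = map₁ suc (peel m xs)
... | no _ = 0 , x ∷ xs

Parsed : Set
Parsed = List (List ℕ) × List Group

parseStep : ℕ × List ℕ → List ℕ → Parsed → Parsed
parseStep (zero , _) v (vs₀ , gs) = v ∷ vs₀ , gs
parseStep (suc k , x) _ (vs₀ , gs) = [] , (k , x , vs₀) ∷ gs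

parse : ℕ → List (List ℕ) → Parsed
parse m [] = [] , []
parse m (v ∷ vs) = parseStep (peel m v) v (parse m vs)

unparse : ℕ → Parsed → List (List ℕ)
unparse m (vs₀ , gs) = vs₀ ++ groupsWords m gs

peel-correct : ∀ m v → replicate (proj₁ (peel m v)) m ++ proj₂ (peel m v) ≡ v
peel-correct m [] = refl
peel-correct m (x ∷ xs) with x ≟ m
... | yes refl = cong (m ∷_) (peel-correct m xs)
... | no _ = refl

peel-notHead : ∀ m v → NotHead m (proj₂ (peel m v))
peel-notHead m [] = nothing
peel-notHead m (x ∷ xs) with x ≟ m
... | yes _ = peel-notHead m xs
... | no x≢m = just x≢m

peel-replicate-++ : ∀ m k {x} → NotHead m x → peel m (replicate k m ++ x) ≡ (k , x)
peel-replicate-++ m zero {[]} _ = refl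
peel-replicate-++ m zero {y ∷ _} (just y≢m) rewrite dec-no (y ≟ m) y≢m = refl
peel-replicate-++ m (suc k) x≢m rewrite ≟-diag {m} refl | peel-replicate-++ m k x≢m = refl

unparse-parseStep : ∀ m v p → unparse m (parseStep (peel m v) v p) ≡ v ∷ unparse m p
unparse-parseStep m v (vs₀ , gs) with peel m v | peel-correct m v
... | zero , _ | _ = refl
... | suc k , x | v≡ = cong (_∷ vs₀ ++ groupsWords m gs) v≡

unparse-parse : ∀ m vs → unparse m (parse m vs) ≡ vs
unparse-parse m [] = refl
unparse-parse m (v ∷ vs) = trans (unparse-parseStep m v (parse m vs)) (cong (v ∷_) (unparse-parse m vs))

GroupNotHead : ℕ → Group → Set
GroupNotHead m (_ , x , ws) = NotHead m x × All (NotHead m) ws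

parse-++ : ∀ m vs₀ {R gs} → All (NotHead m) vs₀ → parse m R ≡ ([] , gs) → parse m (vs₀ ++ R) ≡ (vs₀ , gs)
parse-++ m [] _ eq = eq
parse-++ m (v ∷ vs₀) (v≢m ∷ vs₀≢m) eq =
  cong₂ (λ p q → parseStep p v q) (peel-replicate-++ m 0 v≢m) (parse-++ m vs₀ vs₀≢m eq)

parse-groupsWords : ∀ m gs → All (GroupNotHead m) gs → parse m (groupsWords m gs) ≡ ([] , gs)
parse-groupsWords m [] _ = refl
parse-groupsWords m ((k , x , ws) ∷ gs) ((x≢m , ws≢m) ∷ gs≢m) =
  cong₂ (λ p q → parseStep p (replicate (suc k) m ++ x) q)
    (peel-replicate-++ m (suc k) x≢m) (parse-++ m ws ws≢m (parse-groupsWords m gs gs≢m))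

parse-unparse : ∀ m vs₀ gs → All (NotHead m) vs₀ → All (GroupNotHead m) gs →
                parse m (unparse m (vs₀ , gs)) ≡ (vs₀ , gs)
parse-unparse m vs₀ gs vs₀≢m gs≢m = parse-++ m vs₀ vs₀≢m (parse-groupsWords m gs gs≢m)

leadGroups : (List ℕ → VSeq) → List Block → List Group
leadGroups f = map (map₂ (lead ∘ f))

assemble : ℕ → (List ℕ → VSeq) → Factorisation → VSeq
assemble m f (factors u₀ bs t) =
  proj₁ (f u₀) ++ replicate t m , proj₂ (f u₀) ++ groupsWords m (leadGroups f bs)

decompose : ℕ → List ℕ → VSeq
decompose zero w = w , []
decompose (suc r) w = assemble (suc r) (decompose r) (factorise (suc r) w)

module _ {m : ℕ} {f : List ℕ → VSeq} (flatten-f : ∀ u → flatten (f u) ↭ u) where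

  flatten-groupsWords : ∀ bs t → concat (groupsWords m (leadGroups f bs)) ++ replicate t m ↭ blocksWord m bs t
  flatten-groupsWords [] t = ↭-refl
  flatten-groupsWords ((k , u) ∷ bs) t = begin
    ((R ++ x) ++ concat (ws ++ G)) ++ T      ≡⟨ ++-assoc (R ++ x) _ T ⟩
    (R ++ x) ++ (concat (ws ++ G) ++ T)      ≡⟨ ++-assoc R x _ ⟩
    R ++ x ++ concat (ws ++ G) ++ T          ≡⟨ cong (λ c → R ++ x ++ c ++ T) (concat-++ ws G) ⟨
    R ++ x ++ (concat ws ++ concat G) ++ T   ≡⟨ cong (λ c → R ++ x ++ c) (++-assoc (concat ws) (concat G) T) ⟩
    R ++ x ++ concat ws ++ concat G ++ T     ≡⟨ cong (R ++_) (++-assoc x (concat ws) _) ⟨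
    R ++ flatten (lead (f u)) ++ concat G ++ T
      ↭⟨ ++⁺ˡ R (↭-++⁺ (↭-trans (↭-reflexive (flatten-lead (f u))) (flatten-f u))
                        (flatten-groupsWords bs t)) ⟩
    R ++ u ++ blocksWord m bs t              ∎
    where
    open PermutationReasoning
    R = replicate (suc k) m
    x = proj₁ (lead (f u))
    ws = proj₂ (lead (f u))
    G = groupsWords m (leadGroups f bs)
    T = replicate t m

  flatten-assemble : ∀ F → flatten (assemble m f F) ↭ unfactorise m F
  flatten-assemble (factors u₀ bs t) = begin
    (a ++ T) ++ concat (vs ++ G)        ≡⟨ cong ((a ++ T) ++_) (concat-++ vs G) ⟨
    (a ++ T) ++ (concat vs ++ concat G) ≡⟨ ++-assoc a T _ ⟩
    a ++ T ++ concat vs ++ concat G     ↭⟨ ++⁺ˡ a (++-comm T _) ⟩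
    a ++ (concat vs ++ concat G) ++ T   ≡⟨ cong (a ++_) (++-assoc (concat vs) (concat G) T) ⟩
    a ++ concat vs ++ concat G ++ T     ≡⟨ ++-assoc a (concat vs) _ ⟨
    flatten (f u₀) ++ concat G ++ T     ↭⟨ ↭-++⁺ (flatten-f u₀) (flatten-groupsWords bs t) ⟩
    u₀ ++ blocksWord m bs t             ∎
    where
    open PermutationReasoning
    a = proj₁ (f u₀)
    vs = proj₂ (f u₀)
    G = groupsWords m (leadGroups f bs)
    T = replicate t m

flatten-decompose : ∀ r w → flatten (decompose r w) ↭ w
flatten-decompose zero w = ↭-reflexive (++-identityʳ w)
flatten-decompose (suc r) w =
  ↭-trans (flatten-assemble (flatten-decompose r) (factorise (suc r) w)) (↭-reflexive (unfactorise-factorise (suc r) w))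

replicate-nondecreasing : ∀ {m} t → Nondecreasing (replicate t m)
replicate-nondecreasing zero = []
replicate-nondecreasing (suc zero) = [-]
replicate-nondecreasing (suc (suc t)) = ≤-refl ∷ replicate-nondecreasing (suc t)

nondecreasing-++-replicate : ∀ {m} a t → Nondecreasing a → Letters≤ m a → Nondecreasing (a ++ replicate t m)
nondecreasing-++-replicate [] t _ _ = replicate-nondecreasing t
nondecreasing-++-replicate (x ∷ []) zero _ _ = [-]
nondecreasing-++-replicate (x ∷ []) (suc t) _ (x≤m ∷ []) = x≤m ∷ replicate-nondecreasing (suc t)
nondecreasing-++-replicate (x ∷ y ∷ a) t (x≤y ∷ a↗) (_ ∷ a≤m) =
  x≤y ∷ nondecreasing-++-replicate (y ∷ a) t a↗ a≤m

letters≤0⇒nondecreasing : ∀ {w} → Letters≤ 0 w → Nondecreasing w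
letters≤0⇒nondecreasing [] = []
letters≤0⇒nondecreasing (z≤n ∷ []) = [-]
letters≤0⇒nondecreasing (z≤n ∷ w≤0@(z≤n ∷ _)) = z≤n ∷ letters≤0⇒nondecreasing w≤0

VWord≤-suc : ∀ {r v} → VWord≤ r v → VWord≤ (suc r) v
VWord≤-suc (v-V , v≤r) = v-V , letters≤-suc v≤r

NonEmpty-resp-↭ : ∀ {xs ys} → xs ↭ ys → NonEmpty xs → NonEmpty ys
NonEmpty-resp-↭ {ys = []} xs↭[] nonEmpty with () ← ↭-length xs↭[]
NonEmpty-resp-↭ {ys = _ ∷ _} _ _ = nonEmpty

GroupValid : ℕ → Group → Set
GroupValid r (_ , l) = ValidLead r l

groupsWords-valid : ∀ {r} gs → All (GroupValid r) gs → All (VWord≤ (suc r)) (groupsWords (suc r) gs)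
groupsWords-valid [] _ = []
groupsWords-valid ((k , x , ws) ∷ gs) ((x-tail , ws-ok) ∷ gs-ok) =
  (VTail-plateau k x-tail , ++⁺ (replicate⁺ (suc k) ≤-refl) (letters≤-suc (VTail-letters x-tail))) ∷
  ++⁺ (All.map VWord≤-suc ws-ok) (groupsWords-valid gs gs-ok)

module _ {r : ℕ} {f : List ℕ → VSeq}
         (valid-f : ∀ u → Letters≤ r u → ValidVSeq r (f u)) (flatten-f : ∀ u → flatten (f u) ↭ u) where

  lead-f-valid : ∀ u → NonEmpty u → Letters≤ r u → ValidLead r (lead (f u))
  lead-f-valid u u≢[] u≤r = lead-valid (f u) (valid-f u u≤r) (NonEmpty-resp-↭ (↭-sym (flatten-f u)) u≢[])

  leadGroups-valid : ∀ bs → All (BlockBelow r) bs → All (GroupValid r) (leadGroups f bs)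
  leadGroups-valid [] _ = []
  leadGroups-valid ((_ , u) ∷ bs) ((u≢[] , u≤r) ∷ bs-ok) = lead-f-valid u u≢[] u≤r ∷ leadGroups-valid bs bs-ok

  assemble-valid : ∀ F → FactorsBelow r F → ValidVSeq (suc r) (assemble (suc r) f F)
  assemble-valid (factors u₀ bs t) (u₀≤r , bs-ok) with f u₀ | valid-f u₀ u₀≤r
  ... | a , vs | a↗ , a≤r , vs-ok =
    nondecreasing-++-replicate a t a↗ (letters≤-suc a≤r) ,
    ++⁺ (letters≤-suc a≤r) (replicate⁺ t ≤-refl) ,
    ++⁺ (All.map VWord≤-suc vs-ok) (groupsWords-valid _ (leadGroups-valid bs bs-ok))

decompose-valid : ∀ r w → Letters≤ r w → ValidVSeq r (decompose r w)
decompose-valid zero w w≤0 = letters≤0⇒nondecreasing w≤0 , w≤0 , []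
decompose-valid (suc r) w w≤1+r =
  assemble-valid (decompose-valid r) (flatten-decompose r) (factorise (suc r) w) (factorise-below w w≤1+r)

blocksDec : List Block → ℕ
blocksDec [] = 0
blocksDec ((k , u) ∷ bs) = suc k + (dec u + blocksDec bs)

blocksWord-head : ∀ m bs t → Maybe.All (_≡ m) (head (blocksWord m bs t))
blocksWord-head m [] zero = nothing
blocksWord-head m [] (suc t) = just refl
blocksWord-head m (_ ∷ _) t = just refl

below-blocksWord : ∀ {r u} bs t → Letters≤ r u → BelowHead u (blocksWord (suc r) bs t)
below-blocksWord {r} bs t u≤r = Maybe.map (λ { refl → All.map s≤s u≤r }) (blocksWord-head (suc r) bs t)

dec-blocksWord : ∀ {r} bs t → All (BlockBelow r) bs → dec (blocksWord (suc r) bs t) ≡ blocksDec bs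
dec-blocksWord [] t _ = dec-nondecreasing (replicate-nondecreasing t)
dec-blocksWord {r} ((k , y ∷ u) ∷ bs) t ((_ , u≤r@(y≤r ∷ _)) ∷ bs-ok) = begin
  dec (replicate (suc k) (suc r) ++ (y ∷ u) ++ R)
    ≡⟨ dec-plateau (suc k) (s≤s y≤r) ⟩
  suc k + dec ((y ∷ u) ++ R)
    ≡⟨ cong (suc k +_) (dec-++ (y ∷ u) R (below-blocksWord bs t u≤r)) ⟩
  suc k + (dec (y ∷ u) + dec R)
    ≡⟨ cong (λ n → suc k + (dec (y ∷ u) + n)) (dec-blocksWord bs t bs-ok) ⟩
  suc k + (dec (y ∷ u) + blocksDec bs) ∎
  where
  open ≡-Reasoning
  R = blocksWord (suc r) bs t

dec-unfactorise : ∀ {r} u₀ bs t → Letters≤ r u₀ → All (BlockBelow r) bs →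
                  dec (unfactorise (suc r) (factors u₀ bs t)) ≡ dec u₀ + blocksDec bs
dec-unfactorise u₀ bs t u₀≤r bs-ok =
  trans (dec-++ u₀ _ (below-blocksWord bs t u₀≤r)) (cong (dec u₀ +_) (dec-blocksWord bs t bs-ok))

dec-plateau-VTail : ∀ k {r x} → VTail r x → dec (replicate k (suc r) ++ x) ≡ k + dec x
dec-plateau-VTail k x-tail with VTail-nonEmpty x-tail | VTail-letters x-tail
... | nonEmpty | h≤r ∷ _ = dec-plateau k (s≤s h≤r)

sum-dec-++ : ∀ xs ys → sum (map dec (xs ++ ys)) ≡ sum (map dec xs) + sum (map dec ys)
sum-dec-++ xs ys = trans (cong sum (map-++ dec xs ys)) (sum-++ (map dec xs) (map dec ys))

module _ {r : ℕ} {f : List ℕ → VSeq}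
         (valid-f : ∀ u → Letters≤ r u → ValidVSeq r (f u)) (flatten-f : ∀ u → flatten (f u) ↭ u)
         (dec-f : ∀ u → Letters≤ r u → dec u ≡ sum (map dec (proj₂ (f u)))) where

  decSum-f : ∀ u → Letters≤ r u → decSum (f u) ≡ dec u
  decSum-f u u≤r =
    trans (cong (_+ sum (map dec (proj₂ (f u)))) (dec-nondecreasing (proj₁ (valid-f u u≤r)))) (sym (dec-f u u≤r))

  sum-dec-groupsWords : ∀ bs → All (BlockBelow r) bs →
                        sum (map dec (groupsWords (suc r) (leadGroups f bs))) ≡ blocksDec bs
  sum-dec-groupsWords [] _ = refl
  sum-dec-groupsWords ((k , u) ∷ bs) ((u≢[] , u≤r) ∷ bs-ok) = begin
    dec (replicate (suc k) (suc r) ++ x) + sum (map dec (ws ++ G))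
      ≡⟨ cong₂ _+_ (dec-plateau-VTail (suc k) x-tail) (sum-dec-++ ws G) ⟩
    (suc k + dec x) + (sum (map dec ws) + sum (map dec G))
      ≡⟨ +-assoc (suc k) (dec x) _ ⟩
    suc k + (dec x + (sum (map dec ws) + sum (map dec G)))
      ≡⟨ cong (suc k +_) (+-assoc (dec x) _ _) ⟨
    suc k + (decSum (lead (f u)) + sum (map dec G))
      ≡⟨ cong (λ n → suc k + (n + sum (map dec G))) (decSum-lead (f u)) ⟩
    suc k + (decSum (f u) + sum (map dec G))
      ≡⟨ cong₂ (λ n n′ → suc k + (n + n′)) (decSum-f u u≤r) (sum-dec-groupsWords bs bs-ok) ⟩
    suc k + (dec u + blocksDec bs) ∎
    where
    open ≡-Reasoning
    x = proj₁ (lead (f u))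
    ws = proj₂ (lead (f u))
    x-tail = proj₁ (lead-f-valid valid-f flatten-f u u≢[] u≤r)
    G = groupsWords (suc r) (leadGroups f bs)

  dec-assemble : ∀ F → FactorsBelow r F →
                 sum (map dec (proj₂ (assemble (suc r) f F))) ≡ dec (unfactorise (suc r) F)
  dec-assemble (factors u₀ bs t) (u₀≤r , bs-ok) = begin
    sum (map dec (proj₂ (f u₀) ++ G))                ≡⟨ sum-dec-++ (proj₂ (f u₀)) G ⟩
    sum (map dec (proj₂ (f u₀))) + sum (map dec G)
      ≡⟨ cong₂ _+_ (sym (dec-f u₀ u₀≤r)) (sum-dec-groupsWords bs bs-ok) ⟩
    dec u₀ + blocksDec bs                            ≡⟨ dec-unfactorise u₀ bs t u₀≤r bs-ok ⟨
    dec (unfactorise (suc r) (factors u₀ bs t))      ∎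
    where
    open ≡-Reasoning
    G = groupsWords (suc r) (leadGroups f bs)

dec-decompose : ∀ r w → Letters≤ r w → dec w ≡ sum (map dec (proj₂ (decompose r w)))
dec-decompose zero w w≤0 = dec-nondecreasing (letters≤0⇒nondecreasing w≤0)
dec-decompose (suc r) w w≤1+r = sym (begin
  sum (map dec (proj₂ (decompose (suc r) w)))
    ≡⟨ dec-assemble (decompose-valid r) (flatten-decompose r) (dec-decompose r)
                    (factorise (suc r) w) (factorise-below w w≤1+r) ⟩
  dec (unfactorise (suc r) (factorise (suc r) w))  ≡⟨ cong dec (unfactorise-factorise (suc r) w) ⟩
  dec w                                            ∎)
  where open ≡-Reasoning

parse-valid : ∀ {r} vs → All (VWord≤ (suc r)) vs →
              All (VWord≤ r) (proj₁ (parse (suc r) vs)) × All (GroupValid r) (proj₂ (parse (suc r) vs))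
parse-valid [] _ = [] , []
parse-valid {r} (v ∷ vs) ((v-V , v≤1+r) ∷ vs-ok)
  with parse (suc r) vs | parse-valid vs vs-ok | peel (suc r) v | peel-correct (suc r) v | peel-notHead (suc r) v
... | vs₀ , gs | vs₀-ok , gs-ok | zero , _ | refl | v≢1+r =
  (v-V , VWord-lower v-V v≤1+r v≢1+r) ∷ vs₀-ok , gs-ok
... | vs₀ , gs | vs₀-ok , gs-ok | suc k , x | refl | x≢1+r =
  [] , (plateau-VTail k v-V x≢1+r (++⁻ʳ (replicate (suc k) (suc r)) v≤1+r) , vs₀-ok) ∷ gs-ok

unleadGroups : (VSeq → List ℕ) → List Group → List Block
unleadGroups g = map (map₂ (g ∘ unlead))

regroup : (VSeq → List ℕ) → Factorisation → Parsed → Factorisation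
regroup g (factors a _ t) (vs₀ , gs) = factors (g (a , vs₀)) (unleadGroups g gs) t

disassemble : ℕ → (VSeq → List ℕ) → VSeq → Factorisation
disassemble m g (w₀ , vs) = regroup g (factorise m w₀) (parse m vs)

recompose : ℕ → VSeq → List ℕ
recompose zero (w₀ , _) = w₀
recompose (suc r) s = unfactorise (suc r) (disassemble (suc r) (recompose r) s)

letters≤⇒NotHead : ∀ {r v} → Letters≤ r v → NotHead (suc r) v
letters≤⇒NotHead [] = nothing
letters≤⇒NotHead (x≤r ∷ _) = just (<⇒≢ (s≤s x≤r))

GroupValid⇒GroupNotHead : ∀ {r} {gr : Group} → GroupValid r gr → GroupNotHead (suc r) gr
GroupValid⇒GroupNotHead {gr = _ , _ , _} (x-tail , ws-ok) =
  letters≤⇒NotHead (VTail-letters x-tail) , All.map (letters≤⇒NotHead ∘ proj₂) ws-ok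

factorise-++-replicate : ∀ {r a} t → Letters≤ r a → factorise (suc r) (a ++ replicate t (suc r)) ≡ factors a [] t
factorise-++-replicate {a = a} t a≤r = factorise-unfactorise (factors a [] t) (a≤r , [])

module _ {r : ℕ} {f : List ℕ → VSeq} {g : VSeq → List ℕ}
         (valid-f : ∀ u → Letters≤ r u → ValidVSeq r (f u)) (flatten-f : ∀ u → flatten (f u) ↭ u)
         (g-f : ∀ u → Letters≤ r u → g (f u) ≡ u) where

  unleadGroups-leadGroups : ∀ bs → All (BlockBelow r) bs → unleadGroups g (leadGroups f bs) ≡ bs
  unleadGroups-leadGroups [] _ = refl
  unleadGroups-leadGroups ((k , u) ∷ bs) ((u≢[] , u≤r) ∷ bs-ok) =
    cong₂ (λ u′ bs′ → (k , u′) ∷ bs′)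
      (trans (cong g (unlead-lead (f u) (valid-f u u≤r) (NonEmpty-resp-↭ (↭-sym (flatten-f u)) u≢[]))) (g-f u u≤r))
      (unleadGroups-leadGroups bs bs-ok)

  disassemble-assemble : ∀ F → FactorsBelow r F → disassemble (suc r) g (assemble (suc r) f F) ≡ F
  disassemble-assemble (factors u₀ bs t) (u₀≤r , bs-ok) with f u₀ | valid-f u₀ u₀≤r | g-f u₀ u₀≤r
  ... | a , vs | _ , a≤r , vs-ok | g-f-u₀ =
    trans (cong₂ (regroup g) (factorise-++-replicate t a≤r) parsed)
          (cong₂ (λ u bs′ → factors u bs′ t) g-f-u₀ (unleadGroups-leadGroups bs bs-ok))
    where
    parsed : parse (suc r) (vs ++ groupsWords (suc r) (leadGroups f bs)) ≡ (vs , leadGroups f bs)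
    parsed = parse-unparse (suc r) vs (leadGroups f bs) (All.map (letters≤⇒NotHead ∘ proj₂) vs-ok)
               (All.map (λ {gr} → GroupValid⇒GroupNotHead {r} {gr}) (leadGroups-valid valid-f flatten-f bs bs-ok))

NonEmpty-++ : ∀ {xs} ys → NonEmpty xs → NonEmpty (xs ++ ys)
NonEmpty-++ _ nonEmpty = nonEmpty

flatten-letters : ∀ {r} s → ValidVSeq r s → Letters≤ r (flatten s)
flatten-letters _ (_ , w₀≤r , vs-ok) = ++⁺ w₀≤r (concat⁺ (All.map proj₂ vs-ok))

module _ {r : ℕ} {f : List ℕ → VSeq} {g : VSeq → List ℕ}
         (flatten-f : ∀ u → flatten (f u) ↭ u) (f-g : ∀ s → ValidVSeq r s → f (g s) ≡ s) where

  flatten↭inverse : ∀ s → ValidVSeq r s → flatten s ↭ g s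
  flatten↭inverse s s-ok = subst (_↭ g s) (cong flatten (f-g s s-ok)) (flatten-f (g s))

  inverse-letters : ∀ s → ValidVSeq r s → Letters≤ r (g s)
  inverse-letters s s-ok = All-resp-↭ (flatten↭inverse s s-ok) (flatten-letters s s-ok)

  unleadGroups-below : ∀ gs → All (GroupValid r) gs → All (BlockBelow r) (unleadGroups g gs)
  unleadGroups-below [] _ = []
  unleadGroups-below ((_ , l@(x , ws)) ∷ gs) (l-ok@(x-tail , _) ∷ gs-ok) =
    (NonEmpty-resp-↭ (flatten↭inverse (unlead l) unlead-ok) flatten-nonEmpty , inverse-letters (unlead l) unlead-ok) ∷
    unleadGroups-below gs gs-ok
    where
    unlead-ok = proj₁ (unlead-valid l l-ok)
    flatten-nonEmpty : NonEmpty (flatten (unlead l))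
    flatten-nonEmpty = subst NonEmpty (sym (flatten-unlead l)) (NonEmpty-++ (concat ws) (VTail-nonEmpty x-tail))

  leadGroups-unleadGroups : ∀ gs → All (GroupValid r) gs → leadGroups f (unleadGroups g gs) ≡ gs
  leadGroups-unleadGroups [] _ = refl
  leadGroups-unleadGroups ((k , l) ∷ gs) (l-ok ∷ gs-ok) with unlead-valid l l-ok
  ... | unlead-ok , lead-unlead =
    cong₂ (λ l′ gs′ → (k , l′) ∷ gs′)
      (trans (cong lead (f-g (unlead l) unlead-ok)) lead-unlead) (leadGroups-unleadGroups gs gs-ok)

  assemble-disassemble : ∀ s → ValidVSeq (suc r) s →
                         FactorsBelow r (disassemble (suc r) g s) × assemble (suc r) f (disassemble (suc r) g s) ≡ s
  assemble-disassemble (w₀ , vs) (w₀↗ , w₀≤1+r , vs-ok)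
    with nondecreasing-factors w₀↗ w₀≤1+r | parse (suc r) vs | unparse-parse (suc r) vs | parse-valid vs vs-ok
  ... | a , t , refl , a↗ , a≤r | vs₀ , gs | refl | vs₀-ok , gs-ok
    rewrite factorise-++-replicate t a≤r =
    (inverse-letters (a , vs₀) a-ok , unleadGroups-below gs gs-ok) ,
    cong₂ (λ s gs′ → proj₁ s ++ replicate t (suc r) , proj₂ s ++ groupsWords (suc r) gs′)
      (f-g (a , vs₀) a-ok) (leadGroups-unleadGroups gs gs-ok)
    where
    a-ok : ValidVSeq r (a , vs₀)
    a-ok = a↗ , a≤r , vs₀-ok

recompose-decompose : ∀ r w → Letters≤ r w → recompose r (decompose r w) ≡ w
recompose-decompose zero w _ = refl
recompose-decompose (suc r) w w≤1+r = begin
  unfactorise (suc r) (disassemble (suc r) (recompose r) (assemble (suc r) (decompose r) F))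
    ≡⟨ cong (unfactorise (suc r))
            (disassemble-assemble (decompose-valid r) (flatten-decompose r) (recompose-decompose r) F F-below) ⟩
  unfactorise (suc r) F ≡⟨ unfactorise-factorise (suc r) w ⟩
  w                     ∎
  where
  open ≡-Reasoning
  F = factorise (suc r) w
  F-below = factorise-below w w≤1+r

decompose-recompose : ∀ r s → ValidVSeq r s → decompose r (recompose r s) ≡ s
decompose-recompose zero (w₀ , []) _ = refl
decompose-recompose zero (w₀ , v ∷ vs) (_ , _ , (v-V , v≤0) ∷ _) =
  ⊥-elim (VWord-¬nondecreasing v-V (letters≤0⇒nondecreasing v≤0))
decompose-recompose (suc r) s s-ok
  with D-below , assemble-D ← assemble-disassemble (flatten-decompose r) (decompose-recompose r) s s-ok =
  trans (cong (assemble (suc r) (decompose r)) (factorise-unfactorise _ D-below)) assemble-D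

length-concat : ∀ (vs : List (List ℕ)) → length (concat vs) ≡ sum (map length vs)
length-concat [] = refl
length-concat (v ∷ vs) = trans (length-++ v) (cong (length v +_) (length-concat vs))

length-flatten : ∀ s → length (flatten s) ≡ length (proj₁ s) + sum (map length (proj₂ s))
length-flatten (w₀ , vs) = trans (length-++ w₀) (cong (length w₀ +_) (length-concat vs))

VWord≤-irrelevant : ∀ {r v} (p q : VWord≤ r v) → p ≡ q
VWord≤-irrelevant (p₁ , p₂) (q₁ , q₂) =
  cong₂ _,_ (IsVWord-irrelevant p₁ q₁) (All.irrelevant ≤-irrelevant p₂ q₂)

Seqs-≡ : ∀ {r n} (x y : Seqs r n) → proj₁ x ≡ proj₁ y → x ≡ y
Seqs-≡ (_ , p₁ , p₂ , p₃ , p₄) (_ , q₁ , q₂ , q₃ , q₄) refl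
  rewrite Linked.irrelevant ≤-irrelevant p₁ q₁ | All.irrelevant ≤-irrelevant p₂ q₂
        | All.irrelevant VWord≤-irrelevant p₃ q₃ | ≡-irrelevant p₄ q₄ = refl

W-≡ : ∀ {r n} (x y : W r n) → proj₁ x ≡ proj₁ y → x ≡ y
W-≡ (_ , p₁ , p₂) (_ , q₁ , q₂) refl
  rewrite ≡-irrelevant p₁ q₁ | All.irrelevant ≤-irrelevant p₂ q₂ = refl

toSeqs : ∀ r n → W r n → Seqs r n
toSeqs r n (w , |w|≡n , w≤r) with decompose-valid r w w≤r
... | w₀↗ , w₀≤r , vs-ok =
  decompose r w , w₀↗ , w₀≤r , vs-ok ,
  trans (sym (length-flatten (decompose r w))) (trans (↭-length (flatten-decompose r w)) |w|≡n)

fromSeqs : ∀ r n → Seqs r n → W r n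
fromSeqs r n (s , w₀↗ , w₀≤r , vs-ok , |s|≡n) =
  recompose r s ,
  trans (sym (↭-length flatten↭recompose)) (trans (length-flatten s) |s|≡n) ,
  inverse-letters {f = decompose r} (flatten-decompose r) (decompose-recompose r) s s-ok
  where
  s-ok = w₀↗ , w₀≤r , vs-ok
  flatten↭recompose = flatten↭inverse {f = decompose r} (flatten-decompose r) (decompose-recompose r) s s-ok

theorem3p4 : (r n : ℕ) →
    Σ (W r n ⤖ Seqs r n) λ φ →
      (w : W r n) →
        ((proj₁ (proj₁ (Bijection.to φ w)) ++ concat (proj₂ (proj₁ (Bijection.to φ w)))) ↭ proj₁ w)
        × (dec (proj₁ w) ≡ sum (map dec (proj₂ (proj₁ (Bijection.to φ w)))))
theorem3p4 r n =
  ↔⇒⤖ (mk↔ₛ′ (toSeqs r n) (fromSeqs r n) to-from from-to) ,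
  λ (w , _ , w≤r) → flatten-decompose r w , dec-decompose r w w≤r
  where
  to-from : ∀ y → toSeqs r n (fromSeqs r n y) ≡ y
  to-from y@(s , w₀↗ , w₀≤r , vs-ok , _) = Seqs-≡ _ y (decompose-recompose r s (w₀↗ , w₀≤r , vs-ok))
  from-to : ∀ x → fromSeqs r n (toSeqs r n x) ≡ x
  from-to x@(w , _ , w≤r) = W-≡ _ x (recompose-decompose r w w≤r)
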